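{- There exists a non-deterministic communication protocol in the two-party edge-partition model that, given an $n$-vertex graph $G$ with maximum degree $\Delta$, finds a proper $(\Delta+1)$-coloring of $G$ using $O(n)$ bits of communication.
   Context: Two-party edge-partition model: the input is an undirected graph $G=(V,E)$ on vertex set $[n]$ with maximum degree $\Delta$; $E$ is partitioned into disjoint sets $E_A$ (Alice's) and $E_B$ (Bob's); both players know $n$ and $\Delta$. Non-deterministic version: a prover who knows all edges of $G$ sends a single message to both Alice and Bob; Alice and Bob do not communicate with each other; each either accepts or rejects, and they must agree on a coloring of all vertices. Correctness: for every input there is a prover message that both accept, and whenever the prover's message encodes an improper coloring at least one of them rejects. The cost of the protocol is the length (in bits) of the prover's message. A coloring $C\in[\Delta+1]^n$ is proper if $C(u)\ne C(v)$ for every edge $\{u,v\}\in E$. -}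

module Defs where

open import Data.Nat using (ℕ; suc; _≤_)
open import Data.Fin using (Fin)
open import Data.Bool using (Bool; true; false; _∨_)
open import Data.List using (List; length; filterᵇ; allFin)
open import Data.Product using (_×_; Σ; ∃; ∃-syntax)
open import Relation.Binary.PropositionalEquality using (_≡_; _≢_)
open import Relation.Nullary using (¬_)

EdgeSet : ℕ → Set
EdgeSet n = Fin n → Fin n → Bool

IsGraph : ∀ {n} → EdgeSet n → Set
IsGraph {n} E = (∀ u v → E u v ≡ E v u) × (∀ u → E u u ≡ false)

_∪E_ : ∀ {n} → EdgeSet n → EdgeSet n → EdgeSet n
(E₁ ∪E E₂) u v = E₁ u v ∨ E₂ u v

Disjoint : ∀ {n} → EdgeSet n → EdgeSet n → Set
Disjoint {n} E₁ E₂ = ∀ u v → ¬ (E₁ u v ≡ true × E₂ u v ≡ true)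

degree : ∀ {n} → EdgeSet n → Fin n → ℕ
degree {n} E u = length (filterᵇ (E u) (allFin n))

MaxDegree : ∀ {n} → EdgeSet n → ℕ → Set
MaxDegree {n} E Δ = (∀ u → degree E u ≤ Δ) × ∃[ u ] degree E u ≡ Δ

Coloring : ℕ → ℕ → Set
Coloring n Δ = Fin n → Fin (suc Δ)

ProperColoring : ∀ {n Δ} → EdgeSet n → Coloring n Δ → Set
ProperColoring {n} E C = ∀ u v → E u v ≡ true → C u ≢ C v

-- The prover's message is a bit string.  Alice sees only her edges E_A and the
-- message; Bob sees only E_B and the message.
record NDProtocol (n Δ : ℕ) : Set where
  field
    acceptA : EdgeSet n → List Bool → Bool
    outA    : EdgeSet n → List Bool → Coloring n Δ
    acceptB : EdgeSet n → List Bool → Bool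
    outB    : EdgeSet n → List Bool → Coloring n Δ

ValidInput : (n Δ : ℕ) → EdgeSet n → EdgeSet n → Set
ValidInput n Δ EA EB =
  IsGraph EA × IsGraph EB × Disjoint EA EB × MaxDegree (EA ∪E EB) Δ

CorrectWithCost : ∀ {n Δ} → NDProtocol n Δ → ℕ → Set
CorrectWithCost {n} {Δ} P cost =
  ∀ EA EB → ValidInput n Δ EA EB →
    (∃[ m ] (length m ≤ cost × acceptA EA m ≡ true × acceptB EB m ≡ true))
    × (∀ m → acceptA EA m ≡ true → acceptB EB m ≡ true →
         (outA EA m ≡ outB EB m) × ProperColoring (EA ∪E EB) (outA EA m))
  where open NDProtocol P

module Submission where

-- A graph on [n] of maximum degree Δ has at least ((Δ+1)/3)^n proper (Δ+1)-colourings.  Write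
-- q = Δ+1, N(S) for the number of colourings that are proper on the subgraph induced by S and
-- d_S(v) for the number of neighbours of v in S.  A colouring proper on S∖v stays proper on S for
-- at least q − d_S(v) colours of v, so q N(S) ≥ (q − d_S(v)) N(S∖v) for v ∈ S.  The geometric
-- mean of these inequalities over v ∈ S (removing the vertices in a random order) gives
-- N(S) ≥ q^(n−|S|) ∏_{u∈S} ((q)_{d_S(u)+1})^{1/(d_S(u)+1)}, and (q)_k ≥ (q/3)^k.
-- Hence in every list of such graphs some colouring is proper for a 3^(−n) fraction of them, so
-- 3^n (n²+1) greedily chosen colourings include a proper colouring of each of the fewer than
-- 2^(n²+1) graphs of maximum degree Δ on [n].  The prover sends the 4n-bit index of one that is
-- proper for G, and each player checks it against her own edges.

open import Defs
open import Data.Nat using (ℕ; _*_)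
open import Data.Product using (∃-syntax)

import Algebra.Properties.CommutativeMonoid.Sum as CommutativeMonoidSum
open import Data.Bool using (Bool; true; false; _∧_; _∨_; not)
import Data.Bool.Properties as Bool
open import Data.Fin using (Fin; zero; suc)
open import Data.Fin.Properties using (_≟_; all?)
open import Data.List using (List; []; _∷_; length; filter; filterᵇ; tabulate; map; _++_; cartesianProductWith)
open import Data.List.Membership.Propositional using (_∈_)
open import Data.List.Membership.Propositional.Properties using (∈-filter⁺; ∈-cartesianProductWith⁺)
open import Data.List.Properties using (length-++; length-map; length-filter)
open import Data.List.Relation.Unary.All using (All; []; _∷_)
open import Data.List.Relation.Unary.All.Properties using (filter⁺; all-filter)
open import Data.List.Relation.Unary.Any using (here; there)
open import Data.Nat hiding (_≟_)
open import Data.Nat.Combinatorics.Base using (_P′_)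
open import Data.Nat.Divisibility using (_∣_; ∣-trans; m∣m*n; m≤n⇒m!∣n!)
open import Data.Nat.DivMod using (_/_; m/n*n≡m)
open import Data.Nat.Properties hiding (_≟_)
open import Data.Nat.Tactic.RingSolver using (solve-∀)
open import Data.Product using (_×_; _,_; proj₁; proj₂)
open import Data.Sum using (_⊎_; inj₁; inj₂; [_,_]′)
open import Data.Vec using (Vec; []; _∷_; lookup; _[_]≔_)
import Data.Vec as Vec
open import Data.Vec.Properties using (lookup∘update; lookup∘update′; lookup∘tabulate)
open import Function using (_∘_)
open import Relation.Binary.PropositionalEquality
open import Relation.Nullary using (Dec; yes; no; does; ¬_; ¬?; _→-dec_; _×-dec_; contradiction)
open import Relation.Nullary.Decidable using (dec-true; dec-false)
open import Algebra.Properties.Semiring.Sum +-*-semiring using (*-distribˡ-sum)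

-- Arithmetic

x*[y*z]≡y*[x*z] : ∀ x y z → x * (y * z) ≡ y * (x * z)
x*[y*z]≡y*[x*z] x y z = trans (sym (*-assoc x y z)) (trans (cong (_* z) (*-comm x y)) (*-assoc y x z))

^-distribʳ-* : ∀ x y k → (x * y) ^ k ≡ x ^ k * y ^ k
^-distribʳ-* x y zero = refl
^-distribʳ-* x y (suc k) = trans (cong (x * y *_) (^-distribʳ-* x y k)) (interchange x y (x ^ k) (y ^ k))
  where
  interchange : ∀ a b c d → a * b * (c * d) ≡ a * c * (b * d)
  interchange = solve-∀

[x^m]^k≡[x^k]^m : ∀ x m k → (x ^ m) ^ k ≡ (x ^ k) ^ m
[x^m]^k≡[x^k]^m x m k = trans (^-*-assoc x m k) (trans (cong (x ^_) (*-comm m k)) (sym (^-*-assoc x k m)))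

q^[D*[n∸k]]≡q^D*q^[D*[n∸1+k]] : ∀ q D {n k} → suc k ≤ n → q ^ (D * (n ∸ k)) ≡ q ^ D * q ^ (D * (n ∸ suc k))
q^[D*[n∸k]]≡q^D*q^[D*[n∸1+k]] q D {n} {k} 1+k≤n = begin
  q ^ (D * (n ∸ k))               ≡⟨ cong (λ e → q ^ (D * e)) (+-∸-assoc 1 1+k≤n) ⟩
  q ^ (D * suc (n ∸ suc k))       ≡⟨ cong (q ^_) (*-suc D (n ∸ suc k)) ⟩
  q ^ (D + D * (n ∸ suc k))       ≡⟨ ^-distribˡ-+-* q D (D * (n ∸ suc k)) ⟩
  q ^ D * q ^ (D * (n ∸ suc k))   ∎
  where open ≡-Reasoning

^-cancelʳ-≤ : ∀ k .{{_ : NonZero k}} {x y} → x ^ k ≤ y ^ k → x ≤ y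
^-cancelʳ-≤ k {x} {y} xᵏ≤yᵏ with x ≤? y
... | yes x≤y = x≤y
... | no x≰y = contradiction xᵏ≤yᵏ (<⇒≱ (^-monoˡ-< k (≰⇒> x≰y)))

-- The bound (1 + 1/p)^j ≤ 1 + j/p + (j/p)² for j ≤ p, cleared of denominators.
[1+p]^j*p²≤p^j*[p²+jp+j²] : ∀ {p} j → j ≤ p →
  suc p ^ j * (p * p) ≤ p ^ j * (p * p + j * p + j * j)
[1+p]^j*p²≤p^j*[p²+jp+j²] {p} zero _ = ≤-reflexive (base p)
  where
  base : ∀ p → 1 * (p * p) ≡ 1 * (p * p + 0 * p + 0 * 0)
  base = solve-∀
[1+p]^j*p²≤p^j*[p²+jp+j²] {p} (suc j) j<p = begin
  suc p ^ suc j * (p * p)      ≡⟨ *-assoc (suc p) (suc p ^ j) (p * p) ⟩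
  suc p * (suc p ^ j * (p * p)) ≤⟨ *-monoʳ-≤ (suc p) ([1+p]^j*p²≤p^j*[p²+jp+j²] j (<⇒≤ j<p)) ⟩
  suc p * (p ^ j * Q j)         ≡⟨ x*[y*z]≡y*[x*z] (suc p) (p ^ j) (Q j) ⟩
  p ^ j * (suc p * Q j)         ≤⟨ *-monoʳ-≤ (p ^ j) step ⟩
  p ^ j * (p * Q (suc j))       ≡⟨ x*[y*z]≡y*[x*z] (p ^ j) p (Q (suc j)) ⟩
  p * (p ^ j * Q (suc j))       ≡⟨ *-assoc p (p ^ j) (Q (suc j)) ⟨
  p ^ suc j * Q (suc j)         ∎
  where
  open ≤-Reasoning
  Q : ℕ → ℕ
  Q j = p * p + j * p + j * j
  identity : ∀ p j → suc p * (p * p + j * p + j * j) + (p * j + p)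
                   ≡ p * (p * p + suc j * p + suc j * suc j) + j * j
  identity = solve-∀
  j²≤pj+p : j * j ≤ p * j + p
  j²≤pj+p = ≤-trans (*-monoˡ-≤ j (<⇒≤ j<p)) (m≤m+n (p * j) p)
  step : suc p * Q j ≤ p * Q (suc j)
  step = +-cancelʳ-≤ (p * j + p) (suc p * Q j) (p * Q (suc j))
           (≤-trans (≤-reflexive (identity p j)) (+-monoʳ-≤ (p * Q (suc j)) j²≤pj+p))

[1+p]^j≤3*p^j : ∀ {p} j → j ≤ p → suc p ^ j ≤ 3 * p ^ j
[1+p]^j≤3*p^j {zero} zero _ = s≤s z≤n
[1+p]^j≤3*p^j {p@(suc _)} j j≤p = *-cancelʳ-≤ (suc p ^ j) (3 * p ^ j) (p * p) (begin
  suc p ^ j * (p * p)           ≤⟨ [1+p]^j*p²≤p^j*[p²+jp+j²] j j≤p ⟩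
  p ^ j * (p * p + j * p + j * j) ≤⟨ *-monoʳ-≤ (p ^ j) Q≤3p² ⟩
  p ^ j * (3 * (p * p))         ≡⟨ x*[3*y]≡3*x*y (p ^ j) (p * p) ⟩
  3 * p ^ j * (p * p)           ∎)
  where
  open ≤-Reasoning
  x*[3*y]≡3*x*y : ∀ x y → x * (3 * y) ≡ 3 * x * y
  x*[3*y]≡3*x*y = solve-∀
  x+x+x≡3*x : ∀ x → x + x + x ≡ 3 * x
  x+x+x≡3*x = solve-∀
  Q≤3p² : p * p + j * p + j * j ≤ 3 * (p * p)
  Q≤3p² = ≤-trans (+-mono-≤ (+-monoʳ-≤ (p * p) (*-monoˡ-≤ p j≤p)) (*-mono-≤ j≤p j≤p))
                  (≤-reflexive (x+x+x≡3*x (p * p)))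

[1+q]P′[1+k]≡[1+q]*qP′k : ∀ q k → suc q P′ suc k ≡ suc q * (q P′ k)
[1+q]P′[1+k]≡[1+q]*qP′k q zero = refl
[1+q]P′[1+k]≡[1+q]*qP′k q (suc k) = begin
  (q ∸ k) * (suc q P′ suc k)     ≡⟨ cong ((q ∸ k) *_) ([1+q]P′[1+k]≡[1+q]*qP′k q k) ⟩
  (q ∸ k) * (suc q * (q P′ k))   ≡⟨ x*[y*z]≡y*[x*z] (q ∸ k) (suc q) (q P′ k) ⟩
  suc q * ((q ∸ k) * (q P′ k))   ∎
  where
  open ≡-Reasoning

q^k≤3^k*qP′k : ∀ q k → k ≤ q → q ^ k ≤ 3 ^ k * (q P′ k)
q^k≤3^k*qP′k q zero _ = ≤-refl
q^k≤3^k*qP′k (suc q) (suc k) (s≤s k≤q) = begin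
  suc q * suc q ^ k                 ≤⟨ *-monoʳ-≤ (suc q) ([1+p]^j≤3*p^j k k≤q) ⟩
  suc q * (3 * q ^ k)               ≤⟨ *-monoʳ-≤ (suc q) (*-monoʳ-≤ 3 (q^k≤3^k*qP′k q k k≤q)) ⟩
  suc q * (3 * (3 ^ k * (q P′ k)))  ≡⟨ rearrange (suc q) (3 ^ k) (q P′ k) ⟩
  3 ^ suc k * (suc q * (q P′ k))    ≡⟨ cong (3 ^ suc k *_) ([1+q]P′[1+k]≡[1+q]*qP′k q k) ⟨
  3 ^ suc k * (suc q P′ suc k)      ∎
  where
  open ≤-Reasoning
  rearrange : ∀ x y z → x * (3 * (y * z)) ≡ (3 * y) * (x * z)
  rearrange = solve-∀

x^k*[x+k]≤[1+x]^k*x : ∀ x k → x ^ k * (x + k) ≤ suc x ^ k * x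
x^k*[x+k]≤[1+x]^k*x x zero = ≤-reflexive (cong (_+ 0) (+-identityʳ x))
x^k*[x+k]≤[1+x]^k*x x (suc k) = begin
  x * x ^ k * (x + suc k)                  ≡⟨ split x (x ^ k) k ⟩
  x * (x ^ k * (x + k)) + x ^ k * x        ≤⟨ +-monoʳ-≤ (x * (x ^ k * (x + k))) (*-monoʳ-≤ (x ^ k) (m≤m+n x k)) ⟩
  x * (x ^ k * (x + k)) + x ^ k * (x + k)  ≡⟨ +-comm (x * (x ^ k * (x + k))) (x ^ k * (x + k)) ⟩
  suc x * (x ^ k * (x + k))                ≤⟨ *-monoʳ-≤ (suc x) (x^k*[x+k]≤[1+x]^k*x x k) ⟩
  suc x * (suc x ^ k * x)                  ≡⟨ *-assoc (suc x) (suc x ^ k) x ⟨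
  suc x ^ suc k * x                        ∎
  where
  open ≤-Reasoning
  split : ∀ x y k → x * y * (x + suc k) ≡ x * (y * (x + k)) + y * x
  split = solve-∀

-- (1 − 1/(x+1))^(x+1) ≤ 1/2, by Bernoulli's inequality.
2*x^[1+x]≤[1+x]^[1+x] : ∀ x → 2 * x ^ suc x ≤ suc x ^ suc x
2*x^[1+x]≤[1+x]^[1+x] zero = z≤n
2*x^[1+x]≤[1+x]^[1+x] x@(suc _) = *-cancelʳ-≤ (2 * x ^ suc x) (suc x ^ suc x) x (begin
  2 * x ^ suc x * x          ≡⟨ rearrange (x ^ suc x) x ⟩
  x ^ suc x * (x + x)        ≤⟨ *-monoʳ-≤ (x ^ suc x) (+-monoʳ-≤ x (n≤1+n x)) ⟩
  x ^ suc x * (x + suc x)    ≤⟨ x^k*[x+k]≤[1+x]^k*x x (suc x) ⟩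
  suc x ^ suc x * x          ∎)
  where
  open ≤-Reasoning
  rearrange : ∀ y x → 2 * y * x ≡ y * (x + x)
  rearrange = solve-∀

2^P*[M∸1]^[M*P]≤M^[M*P] : ∀ M .{{_ : NonZero M}} P → 2 ^ P * (M ∸ 1) ^ (M * P) ≤ M ^ (M * P)
2^P*[M∸1]^[M*P]≤M^[M*P] (suc x) P = begin
  2 ^ P * x ^ (suc x * P)        ≡⟨ cong (2 ^ P *_) (^-*-assoc x (suc x) P) ⟨
  2 ^ P * (x ^ suc x) ^ P        ≡⟨ ^-distribʳ-* 2 (x ^ suc x) P ⟨
  (2 * x ^ suc x) ^ P            ≤⟨ ^-monoˡ-≤ P (2*x^[1+x]≤[1+x]^[1+x] x) ⟩
  (suc x ^ suc x) ^ P            ≡⟨ ^-*-assoc (suc x) (suc x) P ⟩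
  suc x ^ (suc x * P)            ∎
  where open ≤-Reasoning

n<2^n : ∀ n → n < 2 ^ n
n<2^n zero = z<s
n<2^n (suc n) = begin-strict
  suc n             <⟨ s<s (n<2^n n) ⟩
  suc (2 ^ n)       ≡⟨ +-comm 1 (2 ^ n) ⟩
  2 ^ n + 1         ≤⟨ +-monoʳ-≤ (2 ^ n) (≤-trans (m^n>0 2 n) (m≤m+n (2 ^ n) 0)) ⟩
  2 ^ n + (2 ^ n + 0) ∎
  where open ≤-Reasoning

3^n*[1+n*n]≤2^[4*n] : ∀ n → 3 ^ n * suc (n * n) ≤ 2 ^ (4 * n)
3^n*[1+n*n]≤2^[4*n] n = begin
  3 ^ n * suc (n * n)         ≤⟨ *-mono-≤ (^-monoˡ-≤ n (s≤s (s≤s (s≤s z≤n)))) (*-mono-< (n<2^n n) (n<2^n n)) ⟩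
  4 ^ n * (2 ^ n * 2 ^ n)     ≡⟨ cong₂ _*_ (sym (^-*-assoc 2 2 n)) (^-distribˡ-+-* 2 n n) ⟨
  2 ^ (2 * n) * 2 ^ (n + n)   ≡⟨ ^-distribˡ-+-* 2 (2 * n) (n + n) ⟨
  2 ^ (2 * n + (n + n))       ≡⟨ cong (2 ^_) (exponent n) ⟩
  2 ^ (4 * n)                 ∎
  where
  open ≤-Reasoning
  exponent : ∀ n → 2 * n + (n + n) ≡ 4 * n
  exponent = solve-∀

module Sum = CommutativeMonoidSum +-0-commutativeMonoid
module Product = CommutativeMonoidSum *-1-commutativeMonoid

open Sum using (sum; sum-syntax; sum-cong-≗; ∑-distrib-+; ∑-comm)

product : ∀ {n} → (Fin n → ℕ) → ℕ
product = Product.sum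

infixl 10 ∏-syntax

∏-syntax : ∀ n → (Fin n → ℕ) → ℕ
∏-syntax _ = product

syntax ∏-syntax n (λ i → x) = ∏[ i < n ] x

∑-mono-≤ : ∀ {n} {f g : Fin n → ℕ} → (∀ i → f i ≤ g i) → sum f ≤ sum g
∑-mono-≤ {zero} f≤g = z≤n
∑-mono-≤ {suc n} f≤g = +-mono-≤ (f≤g zero) (∑-mono-≤ (f≤g ∘ suc))

∑-const : ∀ n c → ∑[ i < n ] c ≡ n * c
∑-const zero c = refl
∑-const (suc n) c = cong (c +_) (∑-const n c)

∑-*ˡ : ∀ {n} c (f : Fin n → ℕ) → ∑[ i < n ] (c * f i) ≡ c * sum f
∑-*ˡ c f = sym (*-distribˡ-sum c f)

∑≤n*max : ∀ {n} .{{_ : NonZero n}} (f : Fin n → ℕ) → ∃[ i ] sum f ≤ n * f i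
∑≤n*max {suc zero} f = zero , ≤-refl
∑≤n*max {suc (suc n)} f with ∑≤n*max (f ∘ suc)
... | i , ∑≤ with f zero ≤? f (suc i)
...   | yes f₀≤fᵢ = suc i , +-mono-≤ f₀≤fᵢ ∑≤
...   | no f₀≰fᵢ = zero , +-monoʳ-≤ (f zero) (≤-trans ∑≤ (*-monoʳ-≤ (suc n) (<⇒≤ (≰⇒> f₀≰fᵢ))))

∏-cong : ∀ {n} {f g : Fin n → ℕ} → (∀ i → f i ≡ g i) → product f ≡ product g
∏-cong = Product.sum-cong-≗

∏-distrib-* : ∀ {n} (f g : Fin n → ℕ) → ∏[ i < n ] (f i * g i) ≡ product f * product g
∏-distrib-* = Product.∑-distrib-+

∏-comm : ∀ {m n} (f : Fin m → Fin n → ℕ) → ∏[ i < m ] ∏[ j < n ] f i j ≡ ∏[ j < n ] ∏[ i < m ] f i j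
∏-comm = Product.∑-comm

∏-mono-≤ : ∀ {n} {f g : Fin n → ℕ} → (∀ i → f i ≤ g i) → product f ≤ product g
∏-mono-≤ {zero} f≤g = ≤-refl
∏-mono-≤ {suc n} f≤g = *-mono-≤ (f≤g zero) (∏-mono-≤ (f≤g ∘ suc))

∏-const : ∀ n c → ∏[ i < n ] c ≡ c ^ n
∏-const zero c = refl
∏-const (suc n) c = cong (c *_) (∏-const n c)

∏-^ : ∀ {n} (f : Fin n → ℕ) k → ∏[ i < n ] (f i ^ k) ≡ product f ^ k
∏-^ {zero} f k = sym (^-zeroˡ k)
∏-^ {suc n} f k = trans (cong (f zero ^ k *_) (∏-^ (f ∘ suc) k)) (sym (^-distribʳ-* (f zero) _ k))

∏-^-sum : ∀ {n} x (g : Fin n → ℕ) → ∏[ i < n ] (x ^ g i) ≡ x ^ sum g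
∏-^-sum {zero} x g = refl
∏-^-sum {suc n} x g = trans (cong (x ^ g zero *_) (∏-^-sum x (g ∘ suc))) (sym (^-distribˡ-+-* x (g zero) _))

∧≡true⇒ : ∀ a {b} → a ∧ b ≡ true → a ≡ true × b ≡ true
∧≡true⇒ true b≡true = refl , b≡true

∨≡true⇒ : ∀ a {b} → a ∨ b ≡ true → a ≡ true ⊎ b ≡ true
∨≡true⇒ true _ = inj₁ refl
∨≡true⇒ false b≡true = inj₂ b≡true

does≡true⇒ : ∀ {a} {A : Set a} (A? : Dec A) → does A? ≡ true → A
does≡true⇒ (yes a) _ = a

does≡false⇒¬ : ∀ {a} {A : Set a} (A? : Dec A) → does A? ≡ false → ¬ A
does≡false⇒¬ (no ¬a) _ = ¬a

⟦_⟧ : Bool → ℕ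
⟦ true ⟧ = 1
⟦ false ⟧ = 0

⟦⟧≤1 : ∀ b → ⟦ b ⟧ ≤ 1
⟦⟧≤1 true = ≤-refl
⟦⟧≤1 false = z≤n

*⟦does⟧≤ : ∀ {a} {A : Set a} (A? : Dec A) {k m} → (A → k ≤ m) → k * ⟦ does A? ⟧ ≤ m
*⟦does⟧≤ (yes a) {k} k≤m = ≤-trans (≤-reflexive (*-identityʳ k)) (k≤m a)
*⟦does⟧≤ (no _) {k} _ = ≤-trans (≤-reflexive (*-zeroʳ k)) z≤n

^⟦⟧-cong : ∀ b {x y} → (b ≡ true → x ≡ y) → x ^ ⟦ b ⟧ ≡ y ^ ⟦ b ⟧
^⟦⟧-cong true x≡y = cong (_* 1) (x≡y refl)
^⟦⟧-cong false _ = refl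

^⟦⟧-mono-≤ : ∀ b {x y} → (b ≡ true → x ≤ y) → x ^ ⟦ b ⟧ ≤ y ^ ⟦ b ⟧
^⟦⟧-mono-≤ true x≤y = *-monoˡ-≤ 1 (x≤y refl)
^⟦⟧-mono-≤ false _ = ≤-refl

count : ∀ {n} → (Fin n → Bool) → ℕ
count {n} p = ∑[ i < n ] ⟦ p i ⟧

_∩_ : ∀ {n} → (Fin n → Bool) → (Fin n → Bool) → Fin n → Bool
(p ∩ r) i = p i ∧ r i

_∖_ : ∀ {n} → (Fin n → Bool) → Fin n → Fin n → Bool
(p ∖ v) w = p w ∧ not (does (w ≟ v))

∈∖ : ∀ {n} {S : Fin n → Bool} {u v} → S u ≡ true → u ≢ v → (S ∖ v) u ≡ true
∈∖ {u = u} {v} Su u≢v rewrite Su | dec-false (u ≟ v) u≢v = refl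

count≤n : ∀ {n} (p : Fin n → Bool) → count p ≤ n
count≤n {n} p = ≤-trans (∑-mono-≤ (⟦⟧≤1 ∘ p)) (≤-reflexive (trans (∑-const n 1) (*-identityʳ n)))

count-mono : ∀ {n} {p r : Fin n → Bool} → (∀ i → p i ≡ true → r i ≡ true) → count p ≤ count r
count-mono {p = p} {r} p⇒r = ∑-mono-≤ ⟦p⟧≤⟦r⟧
  where
  ⟦p⟧≤⟦r⟧ : ∀ i → ⟦ p i ⟧ ≤ ⟦ r i ⟧
  ⟦p⟧≤⟦r⟧ i with p i in pᵢ
  ... | false = z≤n
  ... | true rewrite p⇒r i pᵢ = ≤-refl

count≡0⇒≡false : ∀ {n} (p : Fin n → Bool) → count p ≡ 0 → ∀ i → p i ≡ false
count≡0⇒≡false p #p≡0 zero with p zero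
... | false = refl
count≡0⇒≡false p #p≡0 (suc i) with p zero
... | false = count≡0⇒≡false (p ∘ suc) #p≡0 i

count-split : ∀ {n} (p r : Fin n → Bool) → count p ≡ count (p ∩ r) + count (λ i → p i ∧ not (r i))
count-split p r = trans (sum-cong-≗ (λ i → split (p i) (r i)))
                          (∑-distrib-+ (λ i → ⟦ p i ∧ r i ⟧) (λ i → ⟦ p i ∧ not (r i) ⟧))
  where
  split : ∀ a b → ⟦ a ⟧ ≡ ⟦ a ∧ b ⟧ + ⟦ a ∧ not b ⟧
  split true true = refl
  split true false = refl
  split false b = refl

count-∩-≟ : ∀ {n} (p : Fin n → Bool) v → count (λ w → p w ∧ does (w ≟ v)) ≡ ⟦ p v ⟧
count-∩-≟ {suc n} p zero = begin
  ⟦ p zero ∧ true ⟧ + ∑[ w < n ] ⟦ p (suc w) ∧ false ⟧ ≡⟨ cong₂ _+_ (cong ⟦_⟧ (Bool.∧-identityʳ (p zero))) none ⟩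
  ⟦ p zero ⟧ + 0                                       ≡⟨ +-identityʳ ⟦ p zero ⟧ ⟩
  ⟦ p zero ⟧                                           ∎
  where
  open ≡-Reasoning
  none : ∑[ w < n ] ⟦ p (suc w) ∧ false ⟧ ≡ 0
  none = trans (sum-cong-≗ (λ w → cong ⟦_⟧ (Bool.∧-zeroʳ (p (suc w))))) (trans (∑-const n 0) (*-zeroʳ n))
count-∩-≟ {suc n} p (suc v) = cong₂ _+_ (cong ⟦_⟧ (Bool.∧-zeroʳ (p zero))) (count-∩-≟ (λ w → p (suc w)) v)

count-∖ : ∀ {n} (p : Fin n → Bool) v → count p ≡ ⟦ p v ⟧ + count (p ∖ v)
count-∖ p v = trans (count-split p (λ w → does (w ≟ v))) (cong (_+ count (p ∖ v)) (count-∩-≟ p v))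

∖-∩ : ∀ {n} (S T : Fin n → Bool) v w → ((S ∖ v) ∩ T) w ≡ ((S ∩ T) ∖ v) w
∖-∩ S T v w with S w | T w
... | true | true = Bool.∧-identityʳ _
... | true | false = Bool.∧-zeroʳ _
... | false | _ = refl

count-∖-∈ : ∀ {n} (S : Fin n → Bool) u {k} → S u ≡ true → count S ≡ suc k → count (S ∖ u) ≡ k
count-∖-∈ S u {k} Su #S≡1+k = suc-injective (begin
  suc (count (S ∖ u))         ≡⟨ cong (λ b → ⟦ b ⟧ + count (S ∖ u)) Su ⟨
  ⟦ S u ⟧ + count (S ∖ u)     ≡⟨ count-∖ S u ⟨
  count S                     ≡⟨ #S≡1+k ⟩
  suc k                       ∎)
  where open ≡-Reasoning

∏-^-count : ∀ {n} x (p : Fin n → Bool) → ∏[ i < n ] (x ^ ⟦ p i ⟧) ≡ x ^ count p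
∏-^-count x p = ∏-^-sum x (⟦_⟧ ∘ p)

∑ᶜ : ∀ {q} m → (Vec (Fin q) m → ℕ) → ℕ
∑ᶜ zero f = f []
∑ᶜ {q} (suc m) f = ∑[ a < q ] ∑ᶜ m (λ C → f (a ∷ C))

module _ {q : ℕ} where

  ∑ᶜ-cong : ∀ m {f g : Vec (Fin q) m → ℕ} → (∀ C → f C ≡ g C) → ∑ᶜ m f ≡ ∑ᶜ m g
  ∑ᶜ-cong zero f≡g = f≡g []
  ∑ᶜ-cong (suc m) f≡g = sum-cong-≗ (λ a → ∑ᶜ-cong m (λ C → f≡g (a ∷ C)))

  ∑ᶜ-mono-≤ : ∀ m {f g : Vec (Fin q) m → ℕ} → (∀ C → f C ≤ g C) → ∑ᶜ m f ≤ ∑ᶜ m g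
  ∑ᶜ-mono-≤ zero f≤g = f≤g []
  ∑ᶜ-mono-≤ (suc m) f≤g = ∑-mono-≤ (λ a → ∑ᶜ-mono-≤ m (λ C → f≤g (a ∷ C)))

  ∑ᶜ-*ˡ : ∀ m c (f : Vec (Fin q) m → ℕ) → ∑ᶜ m (λ C → c * f C) ≡ c * ∑ᶜ m f
  ∑ᶜ-*ˡ zero c f = refl
  ∑ᶜ-*ˡ (suc m) c f = trans (sum-cong-≗ (λ a → ∑ᶜ-*ˡ m c (λ C → f (a ∷ C)))) (∑-*ˡ c (λ a → ∑ᶜ m (λ C → f (a ∷ C))))

  ∑ᶜ-const : ∀ m c → ∑ᶜ {q} m (λ _ → c) ≡ q ^ m * c
  ∑ᶜ-const zero c = sym (+-identityʳ c)
  ∑ᶜ-const (suc m) c = begin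
    ∑[ a < q ] ∑ᶜ {q} m (λ _ → c) ≡⟨ sum-cong-≗ {q} (λ a → ∑ᶜ-const m c) ⟩
    ∑[ a < q ] (q ^ m * c)    ≡⟨ ∑-const q (q ^ m * c) ⟩
    q * (q ^ m * c)           ≡⟨ *-assoc q (q ^ m) c ⟨
    q ^ suc m * c             ∎
    where open ≡-Reasoning

  ∑ᶜ-distrib-+ : ∀ m (f g : Vec (Fin q) m → ℕ) → ∑ᶜ m (λ C → f C + g C) ≡ ∑ᶜ m f + ∑ᶜ m g
  ∑ᶜ-distrib-+ zero f g = refl
  ∑ᶜ-distrib-+ (suc m) f g =
    trans (sum-cong-≗ (λ a → ∑ᶜ-distrib-+ m (λ C → f (a ∷ C)) (λ C → g (a ∷ C))))
          (∑-distrib-+ (λ a → ∑ᶜ m (λ C → f (a ∷ C))) (λ a → ∑ᶜ m (λ C → g (a ∷ C))))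

  ∑ᶜ-comm-∑ : ∀ m {k} (f : Vec (Fin q) m → Fin k → ℕ) →
              ∑ᶜ m (λ C → ∑[ j < k ] f C j) ≡ ∑[ j < k ] ∑ᶜ m (λ C → f C j)
  ∑ᶜ-comm-∑ zero f = refl
  ∑ᶜ-comm-∑ (suc m) {k} f = begin
    ∑[ a < q ] ∑ᶜ m (λ C → ∑[ j < k ] f (a ∷ C) j) ≡⟨ sum-cong-≗ (λ a → ∑ᶜ-comm-∑ m (λ C → f (a ∷ C))) ⟩
    ∑[ a < q ] ∑[ j < k ] ∑ᶜ m (λ C → f (a ∷ C) j) ≡⟨ ∑-comm (λ a j → ∑ᶜ m (λ C → f (a ∷ C) j)) ⟩
    ∑[ j < k ] ∑[ a < q ] ∑ᶜ m (λ C → f (a ∷ C) j) ∎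
    where open ≡-Reasoning

  ∑ᶜ-[]≔ : ∀ m (v : Fin m) (f : Vec (Fin q) m → ℕ) →
           ∑ᶜ m (λ C → ∑[ c < q ] f (C [ v ]≔ c)) ≡ q * ∑ᶜ m f
  ∑ᶜ-[]≔ (suc m) zero f = begin
    ∑[ a < q ] ∑ᶜ m (λ C → ∑[ c < q ] f (c ∷ C)) ≡⟨ ∑-const q (∑ᶜ m (λ C → ∑[ c < q ] f (c ∷ C))) ⟩
    q * ∑ᶜ m (λ C → ∑[ c < q ] f (c ∷ C))        ≡⟨ cong (q *_) (∑ᶜ-comm-∑ m (λ C c → f (c ∷ C))) ⟩
    q * ∑[ c < q ] ∑ᶜ m (λ C → f (c ∷ C))        ∎
    where open ≡-Reasoning
  ∑ᶜ-[]≔ (suc m) (suc v) f = begin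
    ∑[ a < q ] ∑ᶜ m (λ C → ∑[ c < q ] f (a ∷ C [ v ]≔ c)) ≡⟨ sum-cong-≗ (λ a → ∑ᶜ-[]≔ m v (λ C → f (a ∷ C))) ⟩
    ∑[ a < q ] (q * ∑ᶜ m (λ C → f (a ∷ C)))             ≡⟨ ∑-*ˡ q (λ a → ∑ᶜ m (λ C → f (a ∷ C))) ⟩
    q * ∑[ a < q ] ∑ᶜ m (λ C → f (a ∷ C))               ∎
    where open ≡-Reasoning

  ∑ᶜ≤q^m*max : ∀ m .{{_ : NonZero q}} (f : Vec (Fin q) m → ℕ) → ∃[ C ] ∑ᶜ m f ≤ q ^ m * f C
  ∑ᶜ≤q^m*max zero f = [] , ≤-reflexive (sym (*-identityˡ (f [])))
  ∑ᶜ≤q^m*max (suc m) f = a ∷ best a , (begin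
    ∑[ b < q ] ∑ᶜ m (λ C → f (b ∷ C)) ≤⟨ ∑-mono-≤ (λ b → proj₂ (∑ᶜ≤q^m*max m (λ C → f (b ∷ C)))) ⟩
    ∑[ b < q ] (q ^ m * g b)          ≡⟨ ∑-*ˡ (q ^ m) g ⟩
    q ^ m * sum g                     ≤⟨ *-monoʳ-≤ (q ^ m) (proj₂ (∑≤n*max g)) ⟩
    q ^ m * (q * g a)                 ≡⟨ *-assoc (q ^ m) q (g a) ⟨
    q ^ m * q * g a                   ≡⟨ cong (_* g a) (*-comm (q ^ m) q) ⟩
    q ^ suc m * g a                   ∎)
    where
    open ≤-Reasoning
    best : Fin q → Vec (Fin q) m
    best b = proj₁ (∑ᶜ≤q^m*max m (λ C → f (b ∷ C)))
    g : Fin q → ℕ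
    g b = f (b ∷ best b)
    a : Fin q
    a = proj₁ (∑≤n*max g)

-- Proper colourings are dense

_↾_ : ∀ {n} → EdgeSet n → (Fin n → Bool) → EdgeSet n
(E ↾ S) u v = S u ∧ S v ∧ E u v

module _ {Δ : ℕ} where

  -- Colourings are vectors rather than functions, so that they can be enumerated and
  -- recoloured (C [ v ]≔ c) without function extensionality.
  Proper : ∀ {n} → EdgeSet n → Vec (Fin (suc Δ)) n → Set
  Proper E C = ProperColoring {Δ = Δ} E (lookup C)

  proper? : ∀ {n} (E : EdgeSet n) (C : Vec (Fin (suc Δ)) n) → Dec (Proper E C)
  proper? E C = all? λ u → all? λ v → E u v Bool.≟ true →-dec ¬? (lookup C u ≟ lookup C v)

  proper-subgraph : ∀ {n} {E E′ : EdgeSet n} {C : Vec (Fin (suc Δ)) n} →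
                    (∀ u v → E′ u v ≡ true → E u v ≡ true) → Proper E C → Proper E′ C
  proper-subgraph E′⊆E proper u v E′uv = proper u v (E′⊆E u v E′uv)

#proper : ∀ Δ {n} → EdgeSet n → ℕ
#proper Δ {n} E = ∑ᶜ n (λ (C : Vec (Fin (suc Δ)) n) → ⟦ does (proper? E C) ⟧)

module Recolouring {n Δ : ℕ} {E : EdgeSet n} (isGraph : IsGraph E) where

  q : ℕ
  q = suc Δ

  deg : (Fin n → Bool) → Fin n → ℕ
  deg S v = count (S ∩ E v)

  deg-∖ : ∀ S u v → deg S u ≡ ⟦ S v ∧ E u v ⟧ + deg (S ∖ v) u
  deg-∖ S u v = trans (count-∖ (S ∩ E u) v) (cong (⟦ S v ∧ E u v ⟧ +_) (sum-cong-≗ (cong ⟦_⟧ ∘ sym ∘ ∖-∩ S (E u) v)))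

  deg-∖-self : ∀ S u → deg (S ∖ u) u ≡ deg S u
  deg-∖-self S u = sym (trans (deg-∖ S u u)
    (cong (λ b → ⟦ b ⟧ + deg (S ∖ u) u) (trans (cong (S u ∧_) (proj₂ isGraph u)) (Bool.∧-zeroʳ (S u)))))

  recolour-proper : ∀ S (C : Vec (Fin q) n) v c → Proper (E ↾ (S ∖ v)) C →
                    (∀ u → (S ∩ E v) u ≡ true → lookup C u ≢ c) → Proper (E ↾ S) (C [ v ]≔ c)
  recolour-proper S C v c proper avoids u w uw∈E↾S with ∧≡true⇒ (S u) uw∈E↾S
  ... | Su , Sw∧Euw with ∧≡true⇒ (S w) Sw∧Euw
  ... | Sw , Euw with u ≟ v | w ≟ v
  ...   | yes refl | yes refl = contradiction (trans (sym Euw) (proj₂ isGraph u)) λ ()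
  ...   | yes refl | no w≢v rewrite lookup∘update u C c | lookup∘update′ w≢v C c =
    λ c≡Cw → avoids w (cong₂ _∧_ Sw Euw) (sym c≡Cw)
  ...   | no u≢v | yes refl rewrite lookup∘update w C c | lookup∘update′ u≢v C c =
    avoids u (cong₂ _∧_ Su (trans (proj₁ isGraph w u) Euw))
  ...   | no u≢v | no w≢v rewrite lookup∘update′ u≢v C c | lookup∘update′ w≢v C c =
    proper u w (cong₂ _∧_ (∈∖ {S = S} Su u≢v) (cong₂ _∧_ (∈∖ {S = S} Sw w≢v) Euw))

  N : (Fin n → Bool) → ℕ
  N S = #proper Δ (E ↾ S)

  hits : (Fin n → Bool) → Vec (Fin q) n → Fin n → Fin q → ℕ
  hits S C v c = count (λ u → (S ∩ E v) u ∧ does (c ≟ lookup C u))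

  hits≡0⇒avoids : ∀ S C v c → hits S C v c ≡ 0 → ∀ u → (S ∩ E v) u ≡ true → lookup C u ≢ c
  hits≡0⇒avoids S C v c #hits≡0 u u∈S∩Ev Cu≡c = does≡false⇒¬ (c ≟ lookup C u)
    (trans (cong (_∧ does (c ≟ lookup C u)) (sym u∈S∩Ev)) (count≡0⇒≡false _ #hits≡0 u)) (sym Cu≡c)

  1≤⟦proper⟧+hits : ∀ S C v c → Proper (E ↾ (S ∖ v)) C →
                    1 ≤ ⟦ does (proper? (E ↾ S) (C [ v ]≔ c)) ⟧ + hits S C v c
  1≤⟦proper⟧+hits S C v c proper with hits S C v c in #hits≡
  ... | suc k = ≤-trans (s≤s z≤n) (m≤n+m (suc k) _)
  ... | zero rewrite dec-true (proper? (E ↾ S) (C [ v ]≔ c))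
                              (recolour-proper S C v c proper (hits≡0⇒avoids S C v c #hits≡)) = ≤-refl

  ∑hits≡deg : ∀ S C v → ∑[ c < q ] hits S C v c ≡ deg S v
  ∑hits≡deg S C v = trans (∑-comm (λ c u → ⟦ (S ∩ E v) u ∧ does (c ≟ lookup C u) ⟧))
                          (sum-cong-≗ (λ u → count-∩-≟ (λ _ → (S ∩ E v) u) (lookup C u)))

  recolourings : ∀ S C v → (q ∸ deg S v) * ⟦ does (proper? (E ↾ (S ∖ v)) C) ⟧
                           ≤ ∑[ c < q ] ⟦ does (proper? (E ↾ S) (C [ v ]≔ c)) ⟧
  recolourings S C v = *⟦does⟧≤ (proper? (E ↾ (S ∖ v)) C) λ proper → m≤n+o⇒m∸n≤o q (deg S v) (begin
    q                                                 ≡⟨ trans (∑-const q 1) (*-identityʳ q) ⟨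
    ∑[ c < q ] 1                                      ≤⟨ ∑-mono-≤ (λ c → 1≤⟦proper⟧+hits S C v c proper) ⟩
    ∑[ c < q ] (⟦ proper-after c ⟧ + hits S C v c)    ≡⟨ ∑-distrib-+ (λ c → ⟦ proper-after c ⟧) (hits S C v) ⟩
    ∑[ c < q ] ⟦ proper-after c ⟧ + ∑[ c < q ] hits S C v c ≡⟨ cong (∑[ c < q ] ⟦ proper-after c ⟧ +_) (∑hits≡deg S C v) ⟩
    ∑[ c < q ] ⟦ proper-after c ⟧ + deg S v          ≡⟨ +-comm (∑[ c < q ] ⟦ proper-after c ⟧) (deg S v) ⟩
    deg S v + ∑[ c < q ] ⟦ proper-after c ⟧          ∎)
    where
    open ≤-Reasoning
    proper-after : Fin q → Bool
    proper-after c = does (proper? (E ↾ S) (C [ v ]≔ c))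

  extension : ∀ S v → (q ∸ deg S v) * N (S ∖ v) ≤ q * N S
  extension S v = begin
    (q ∸ deg S v) * N (S ∖ v)
      ≡⟨ ∑ᶜ-*ˡ n (q ∸ deg S v) (λ C → ⟦ does (proper? (E ↾ (S ∖ v)) C) ⟧) ⟨
    ∑ᶜ n (λ C → (q ∸ deg S v) * ⟦ does (proper? (E ↾ (S ∖ v)) C) ⟧) ≤⟨ ∑ᶜ-mono-≤ n (λ C → recolourings S C v) ⟩
    ∑ᶜ n (λ C → ∑[ c < q ] ⟦ does (proper? (E ↾ S) (C [ v ]≔ c)) ⟧) ≡⟨ ∑ᶜ-[]≔ n v (λ C → ⟦ does (proper? (E ↾ S) C) ⟧) ⟩
    q * N S                                                      ∎
    where open ≤-Reasoning

module Weights (Δ : ℕ) where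

  q : ℕ
  q = suc Δ

  D : ℕ
  D = q !

  -- a d = ((q)_(d+1))^(1/(d+1)), raised to the power D so that it is an integer.
  a : ℕ → ℕ
  a d = (q P′ suc d) ^ (D / suc d)

  1+d∣D : ∀ {d} → d ≤ Δ → suc d ∣ D
  1+d∣D {d} d≤Δ = ∣-trans (m∣m*n (d !)) (m≤n⇒m!∣n! (s≤s d≤Δ))

  a^[1+d]≡qP′[1+d]^D : ∀ {d} → d ≤ Δ → a d ^ suc d ≡ (q P′ suc d) ^ D
  a^[1+d]≡qP′[1+d]^D {d} d≤Δ =
    trans (^-*-assoc (q P′ suc d) (D / suc d) (suc d)) (cong ((q P′ suc d) ^_) (m/n*n≡m (1+d∣D d≤Δ)))

  [q∸d]^D*a[d∸1]^d≡a^[1+d] : ∀ {d} → d ≤ Δ → (q ∸ d) ^ D * a (d ∸ 1) ^ d ≡ a d ^ suc d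
  [q∸d]^D*a[d∸1]^d≡a^[1+d] {zero} 0≤Δ = begin
    q ^ D * 1         ≡⟨ *-identityʳ (q ^ D) ⟩
    q ^ D             ≡⟨ cong (_^ D) (*-identityʳ q) ⟨
    (q P′ 1) ^ D      ≡⟨ a^[1+d]≡qP′[1+d]^D 0≤Δ ⟨
    a 0 ^ 1           ∎
    where open ≡-Reasoning
  [q∸d]^D*a[d∸1]^d≡a^[1+d] {suc d} 1+d≤Δ = begin
    (q ∸ suc d) ^ D * a d ^ suc d              ≡⟨ cong ((q ∸ suc d) ^ D *_) (a^[1+d]≡qP′[1+d]^D (<⇒≤ 1+d≤Δ)) ⟩
    (q ∸ suc d) ^ D * (q P′ suc d) ^ D         ≡⟨ ^-distribʳ-* (q ∸ suc d) (q P′ suc d) D ⟨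
    (q P′ suc (suc d)) ^ D                     ≡⟨ a^[1+d]≡qP′[1+d]^D 1+d≤Δ ⟨
    a (suc d) ^ suc (suc d)                    ∎
    where open ≡-Reasoning

  [q∸d]^D*a[d∸1]^d*a^[k∸d]≡a^[1+k] : ∀ {d k} → d ≤ Δ → d ≤ k →
    (q ∸ d) ^ D * (a (d ∸ 1) ^ d * a d ^ (k ∸ d)) ≡ a d ^ suc k
  [q∸d]^D*a[d∸1]^d*a^[k∸d]≡a^[1+k] {d} {k} d≤Δ d≤k = begin
    (q ∸ d) ^ D * (a (d ∸ 1) ^ d * a d ^ (k ∸ d)) ≡⟨ *-assoc ((q ∸ d) ^ D) _ _ ⟨
    (q ∸ d) ^ D * a (d ∸ 1) ^ d * a d ^ (k ∸ d)   ≡⟨ cong (_* a d ^ (k ∸ d)) ([q∸d]^D*a[d∸1]^d≡a^[1+d] d≤Δ) ⟩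
    a d ^ suc d * a d ^ (k ∸ d)                   ≡⟨ ^-distribˡ-+-* (a d) (suc d) (k ∸ d) ⟨
    a d ^ (suc d + (k ∸ d))                       ≡⟨ cong (λ e → a d ^ suc e) (m+[n∸m]≡n d≤k) ⟩
    a d ^ suc k                                   ∎
    where open ≡-Reasoning

  q^D≤3^D*a : ∀ {d} → d ≤ Δ → q ^ D ≤ 3 ^ D * a d
  q^D≤3^D*a {d} d≤Δ = begin
    q ^ D                         ≡⟨ cong (q ^_) (trans (*-comm (suc d) e) (m/n*n≡m (1+d∣D d≤Δ))) ⟨
    q ^ (suc d * e)               ≡⟨ ^-*-assoc q (suc d) e ⟨
    (q ^ suc d) ^ e               ≤⟨ ^-monoˡ-≤ e (q^k≤3^k*qP′k q (suc d) (s≤s d≤Δ)) ⟩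
    (3 ^ suc d * (q P′ suc d)) ^ e ≡⟨ ^-distribʳ-* (3 ^ suc d) (q P′ suc d) e ⟩
    (3 ^ suc d) ^ e * a d         ≡⟨ cong (_* a d) (^-*-assoc 3 (suc d) e) ⟩
    3 ^ (suc d * e) * a d         ≡⟨ cong (λ x → 3 ^ x * a d) (trans (*-comm (suc d) e) (m/n*n≡m (1+d∣D d≤Δ))) ⟩
    3 ^ D * a d                   ∎
    where
    open ≤-Reasoning
    e : ℕ
    e = D / suc d

module Density {n Δ : ℕ} {E : EdgeSet n} (isGraph : IsGraph E) (Δ-bound : ∀ v → count (E v) ≤ Δ) where

  open Recolouring {Δ = Δ} isGraph
  open Weights Δ hiding (q)

  deg≤Δ : ∀ S v → deg S v ≤ Δ
  deg≤Δ S v = ≤-trans (count-mono (λ w → proj₂ ∘ ∧≡true⇒ (S w))) (Δ-bound v)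

  W : (Fin n → Bool) → ℕ
  W S = ∏[ u < n ] (a (deg S u) ^ ⟦ S u ⟧)

  removal-factor : ∀ S u v → S u ≡ true →
    (a (deg (S ∖ v) u) ^ ⟦ (S ∖ v) u ⟧) ^ ⟦ S v ⟧
      ≡ a (deg S u ∸ 1) ^ ⟦ (S ∖ u) v ∧ E u v ⟧ * a (deg S u) ^ ⟦ (S ∖ u) v ∧ not (E u v) ⟧
  removal-factor S u v Su with S v in Sv
  ... | false = refl
  ... | true with v ≟ u
  ...   | yes refl rewrite dec-true (u ≟ u) refl | Su = refl
  ...   | no v≢u rewrite dec-false (u ≟ v) (v≢u ∘ sym) | Su | deg-∖ S u v | Sv with E u v
  ...     | true = refl
  ...     | false = trans (*-identityʳ _) (sym (+-identityʳ _))

  non-neighbours : (Fin n → Bool) → Fin n → Fin n → Bool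
  non-neighbours S u v = (S ∖ u) v ∧ not (E u v)

  k≡deg+#non-neighbours : ∀ S u {k} → S u ≡ true → count S ≡ suc k →
                          k ≡ deg S u + count (non-neighbours S u)
  k≡deg+#non-neighbours S u {k} Su #S≡1+k = begin
    k                                                     ≡⟨ count-∖-∈ S u Su #S≡1+k ⟨
    count (S ∖ u)                                         ≡⟨ count-split (S ∖ u) (E u) ⟩
    deg (S ∖ u) u + count (non-neighbours S u)            ≡⟨ cong (_+ count (non-neighbours S u)) (deg-∖-self S u) ⟩
    deg S u + count (non-neighbours S u)                  ∎
    where open ≡-Reasoning

  -- The part of ∏_{v∈S} W(S∖v) contributed by u ∈ S (with |S| = k + 1): removing one of the
  -- d neighbours of u lowers its degree to d − 1, removing one of the other k − d vertices does not.
  share : (Fin n → Bool) → ℕ → Fin n → ℕ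
  share S k u = a (deg S u ∸ 1) ^ deg S u * a (deg S u) ^ (k ∸ deg S u)

  ∏-removal-factor≡share : ∀ S u {k} → count S ≡ suc k →
    ∏[ v < n ] ((a (deg (S ∖ v) u) ^ ⟦ (S ∖ v) u ⟧) ^ ⟦ S v ⟧) ≡ share S k u ^ ⟦ S u ⟧
  ∏-removal-factor≡share S u {k} #S≡1+k = by-membership (S u) refl
    where
    d : ℕ
    d = deg S u
    factor : Fin n → ℕ
    factor v = (a (deg (S ∖ v) u) ^ ⟦ (S ∖ v) u ⟧) ^ ⟦ S v ⟧
    by-membership : ∀ b → S u ≡ b → product factor ≡ share S k u ^ ⟦ b ⟧
    by-membership false Su = trans (∏-cong trivial) (trans (∏-const n 1) (^-zeroˡ n))
      where
      trivial : ∀ v → factor v ≡ 1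
      trivial v = trans (cong (λ b → (a (deg (S ∖ v) u) ^ ⟦ b ⟧) ^ ⟦ S v ⟧) (cong (_∧ _) Su)) (^-zeroˡ ⟦ S v ⟧)
    by-membership true Su = begin
      product factor
        ≡⟨ ∏-cong (λ v → removal-factor S u v Su) ⟩
      ∏[ v < n ] (a (d ∸ 1) ^ ⟦ (S ∖ u) v ∧ E u v ⟧ * a d ^ ⟦ non-neighbours S u v ⟧)
        ≡⟨ ∏-distrib-* (λ v → a (d ∸ 1) ^ ⟦ (S ∖ u) v ∧ E u v ⟧) (λ v → a d ^ ⟦ non-neighbours S u v ⟧) ⟩
      ∏[ v < n ] (a (d ∸ 1) ^ ⟦ (S ∖ u) v ∧ E u v ⟧) * ∏[ v < n ] (a d ^ ⟦ non-neighbours S u v ⟧)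
        ≡⟨ cong₂ _*_ (∏-^-count (a (d ∸ 1)) ((S ∖ u) ∩ E u)) (∏-^-count (a d) (non-neighbours S u)) ⟩
      a (d ∸ 1) ^ deg (S ∖ u) u * a d ^ count (non-neighbours S u)
        ≡⟨ cong₂ (λ e f → a (d ∸ 1) ^ e * a d ^ f) (deg-∖-self S u) #non-neighbours ⟩
      share S k u
        ≡⟨ *-identityʳ (share S k u) ⟨
      share S k u ^ 1 ∎
      where
      open ≡-Reasoning
      #non-neighbours : count (non-neighbours S u) ≡ k ∸ d
      #non-neighbours = trans (sym (m+n∸m≡n d _)) (cong (_∸ d) (sym (k≡deg+#non-neighbours S u Su #S≡1+k)))

  ∏W∖≡∏share : ∀ S {k} → count S ≡ suc k → ∏[ v < n ] (W (S ∖ v) ^ ⟦ S v ⟧) ≡ ∏[ u < n ] (share S k u ^ ⟦ S u ⟧)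
  ∏W∖≡∏share S #S≡1+k = begin
    ∏[ v < n ] (W (S ∖ v) ^ ⟦ S v ⟧)
      ≡⟨ ∏-cong (λ v → ∏-^ (λ u → a (deg (S ∖ v) u) ^ ⟦ (S ∖ v) u ⟧) ⟦ S v ⟧) ⟨
    ∏[ v < n ] ∏[ u < n ] ((a (deg (S ∖ v) u) ^ ⟦ (S ∖ v) u ⟧) ^ ⟦ S v ⟧)
      ≡⟨ ∏-comm (λ v u → (a (deg (S ∖ v) u) ^ ⟦ (S ∖ v) u ⟧) ^ ⟦ S v ⟧) ⟩
    ∏[ u < n ] ∏[ v < n ] ((a (deg (S ∖ v) u) ^ ⟦ (S ∖ v) u ⟧) ^ ⟦ S v ⟧)
      ≡⟨ ∏-cong (λ u → ∏-removal-factor≡share S u #S≡1+k) ⟩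
    ∏[ u < n ] (share S _ u ^ ⟦ S u ⟧) ∎
    where open ≡-Reasoning

  ∏-extension≡W^[1+k] : ∀ S {k} → count S ≡ suc k →
    ∏[ v < n ] (((q ∸ deg S v) ^ D * W (S ∖ v)) ^ ⟦ S v ⟧) ≡ W S ^ suc k
  ∏-extension≡W^[1+k] S {k} #S≡1+k = begin
    ∏[ v < n ] ((G v * W (S ∖ v)) ^ ⟦ S v ⟧)
      ≡⟨ ∏-cong (λ v → ^-distribʳ-* (G v) (W (S ∖ v)) ⟦ S v ⟧) ⟩
    ∏[ v < n ] (G v ^ ⟦ S v ⟧ * W (S ∖ v) ^ ⟦ S v ⟧)
      ≡⟨ ∏-distrib-* (λ v → G v ^ ⟦ S v ⟧) (λ v → W (S ∖ v) ^ ⟦ S v ⟧) ⟩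
    ∏[ v < n ] (G v ^ ⟦ S v ⟧) * ∏[ v < n ] (W (S ∖ v) ^ ⟦ S v ⟧)
      ≡⟨ cong (∏[ v < n ] (G v ^ ⟦ S v ⟧) *_) (∏W∖≡∏share S #S≡1+k) ⟩
    ∏[ u < n ] (G u ^ ⟦ S u ⟧) * ∏[ u < n ] (share S k u ^ ⟦ S u ⟧)
      ≡⟨ ∏-distrib-* (λ u → G u ^ ⟦ S u ⟧) (λ u → share S k u ^ ⟦ S u ⟧) ⟨
    ∏[ u < n ] (G u ^ ⟦ S u ⟧ * share S k u ^ ⟦ S u ⟧)
      ≡⟨ ∏-cong (λ u → ^-distribʳ-* (G u) (share S k u) ⟦ S u ⟧) ⟨
    ∏[ u < n ] ((G u * share S k u) ^ ⟦ S u ⟧)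
      ≡⟨ ∏-cong (λ u → ^⟦⟧-cong (S u) (λ Su → [q∸d]^D*a[d∸1]^d*a^[k∸d]≡a^[1+k] (deg≤Δ S u) (deg≤k u Su))) ⟩
    ∏[ u < n ] ((a (deg S u) ^ suc k) ^ ⟦ S u ⟧)
      ≡⟨ ∏-cong (λ u → [x^m]^k≡[x^k]^m (a (deg S u)) (suc k) ⟦ S u ⟧) ⟩
    ∏[ u < n ] ((a (deg S u) ^ ⟦ S u ⟧) ^ suc k)
      ≡⟨ ∏-^ (λ u → a (deg S u) ^ ⟦ S u ⟧) (suc k) ⟩
    W S ^ suc k ∎
    where
    open ≡-Reasoning
    G : Fin n → ℕ
    G v = (q ∸ deg S v) ^ D
    deg≤k : ∀ u → S u ≡ true → deg S u ≤ k
    deg≤k u Su = ≤-trans (m≤m+n (deg S u) _) (≤-reflexive (sym (k≡deg+#non-neighbours S u Su #S≡1+k)))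

  W-∅ : ∀ S → count S ≡ 0 → W S ≡ 1
  W-∅ S #S≡0 = trans (∏-cong (λ u → cong (λ b → a (deg S u) ^ ⟦ b ⟧) (count≡0⇒≡false S #S≡0 u)))
                     (trans (∏-const n 1) (^-zeroˡ n))

  N-∅ : ∀ S → count S ≡ 0 → N S ≡ q ^ n
  N-∅ S #S≡0 = trans (∑ᶜ-cong n (λ C → cong ⟦_⟧ (dec-true (proper? (E ↾ S) C) (vacuous C))))
                     (trans (∑ᶜ-const n 1) (*-identityʳ (q ^ n)))
    where
    vacuous : ∀ C → Proper (E ↾ S) C
    vacuous C u v uv∈E↾S = contradiction (trans (sym (proj₁ (∧≡true⇒ (S u) uv∈E↾S))) (count≡0⇒≡false S #S≡0 u)) λ ()

  LowerBound : ℕ → Set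
  LowerBound k = ∀ S → count S ≡ k → q ^ (D * (n ∸ k)) * W S ≤ N S ^ D

  lower-bound-∅ : LowerBound 0
  lower-bound-∅ S #S≡0 = ≤-reflexive (begin
    q ^ (D * n) * W S ≡⟨ cong (q ^ (D * n) *_) (W-∅ S #S≡0) ⟩
    q ^ (D * n) * 1   ≡⟨ *-identityʳ _ ⟩
    q ^ (D * n)       ≡⟨ cong (q ^_) (*-comm D n) ⟩
    q ^ (n * D)       ≡⟨ ^-*-assoc q n D ⟨
    (q ^ n) ^ D       ≡⟨ cong (_^ D) (N-∅ S #S≡0) ⟨
    N S ^ D           ∎)
    where open ≡-Reasoning

  lower-bound-step : ∀ k → LowerBound k → LowerBound (suc k)
  lower-bound-step k lower-bound S #S≡1+k = *-cancelˡ-≤ (q ^ D) {{m^n≢0 q D}} (begin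
    q ^ D * (q ^ (D * (n ∸ suc k)) * W S) ≡⟨ *-assoc (q ^ D) _ (W S) ⟨
    q ^ D * q ^ (D * (n ∸ suc k)) * W S   ≡⟨ cong (_* W S) (q^[D*[n∸k]]≡q^D*q^[D*[n∸1+k]] q D 1+k≤n) ⟨
    B * W S                               ≤⟨ ^-cancelʳ-≤ (suc k) product-bound ⟩
    q ^ D * N S ^ D                       ∎)
    where
    open ≤-Reasoning
    1+k≤n : suc k ≤ n
    1+k≤n = ≤-trans (≤-reflexive (sym #S≡1+k)) (count≤n S)
    B : ℕ
    B = q ^ (D * (n ∸ k))
    factor : Fin n → ℕ
    factor v = (q ∸ deg S v) ^ D * W (S ∖ v)
    factor-bound : ∀ v → S v ≡ true → B * factor v ≤ q ^ D * N S ^ D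
    factor-bound v Sv = begin
      B * ((q ∸ deg S v) ^ D * W (S ∖ v))   ≡⟨ x*[y*z]≡y*[x*z] B ((q ∸ deg S v) ^ D) (W (S ∖ v)) ⟩
      (q ∸ deg S v) ^ D * (B * W (S ∖ v))   ≤⟨ *-monoʳ-≤ ((q ∸ deg S v) ^ D) (lower-bound (S ∖ v) #S∖v≡k) ⟩
      (q ∸ deg S v) ^ D * N (S ∖ v) ^ D     ≡⟨ ^-distribʳ-* (q ∸ deg S v) (N (S ∖ v)) D ⟨
      ((q ∸ deg S v) * N (S ∖ v)) ^ D       ≤⟨ ^-monoˡ-≤ D (extension S v) ⟩
      (q * N S) ^ D                         ≡⟨ ^-distribʳ-* q (N S) D ⟩
      q ^ D * N S ^ D                       ∎
      where
      #S∖v≡k : count (S ∖ v) ≡ k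
      #S∖v≡k = count-∖-∈ S v Sv #S≡1+k
    product-bound : (B * W S) ^ suc k ≤ (q ^ D * N S ^ D) ^ suc k
    product-bound = begin
      (B * W S) ^ suc k                               ≡⟨ ^-distribʳ-* B (W S) (suc k) ⟩
      B ^ suc k * W S ^ suc k
        ≡⟨ cong₂ _*_ (trans (∏-^-count B S) (cong (B ^_) #S≡1+k)) (∏-extension≡W^[1+k] S #S≡1+k) ⟨
      ∏[ v < n ] (B ^ ⟦ S v ⟧) * ∏[ v < n ] (factor v ^ ⟦ S v ⟧)
        ≡⟨ ∏-distrib-* (λ v → B ^ ⟦ S v ⟧) (λ v → factor v ^ ⟦ S v ⟧) ⟨
      ∏[ v < n ] (B ^ ⟦ S v ⟧ * factor v ^ ⟦ S v ⟧)  ≡⟨ ∏-cong (λ v → ^-distribʳ-* B (factor v) ⟦ S v ⟧) ⟨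
      ∏[ v < n ] ((B * factor v) ^ ⟦ S v ⟧)          ≤⟨ ∏-mono-≤ (λ v → ^⟦⟧-mono-≤ (S v) (factor-bound v)) ⟩
      ∏[ v < n ] ((q ^ D * N S ^ D) ^ ⟦ S v ⟧)       ≡⟨ ∏-^-count (q ^ D * N S ^ D) S ⟩
      (q ^ D * N S ^ D) ^ count S                    ≡⟨ cong ((q ^ D * N S ^ D) ^_) #S≡1+k ⟩
      (q ^ D * N S ^ D) ^ suc k                      ∎

  lower-bound : ∀ k → LowerBound k
  lower-bound zero = lower-bound-∅
  lower-bound (suc k) = lower-bound-step k (lower-bound k)

  proper-colourings-dense : q ^ n ≤ 3 ^ n * #proper Δ E
  proper-colourings-dense = ^-cancelʳ-≤ D {{q !≢0}} (begin
    (q ^ n) ^ D                              ≡⟨ [x^m]^k≡[x^k]^m q n D ⟩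
    (q ^ D) ^ n                              ≡⟨ ∏-const n (q ^ D) ⟨
    ∏[ u < n ] (q ^ D)                       ≤⟨ ∏-mono-≤ (λ u → q^D≤3^D*a (deg≤Δ all u)) ⟩
    ∏[ u < n ] (3 ^ D * a (deg all u))       ≡⟨ ∏-distrib-* (λ _ → 3 ^ D) (λ u → a (deg all u)) ⟩
    ∏[ u < n ] (3 ^ D) * ∏[ u < n ] a (deg all u)
      ≡⟨ cong₂ _*_ (∏-const n (3 ^ D)) (∏-cong {n} (λ u → sym (*-identityʳ (a (deg all u))))) ⟩
    (3 ^ D) ^ n * W all                      ≤⟨ *-monoʳ-≤ ((3 ^ D) ^ n) W-all≤ ⟩
    (3 ^ D) ^ n * #proper Δ E ^ D            ≡⟨ cong (_* #proper Δ E ^ D) ([x^m]^k≡[x^k]^m 3 D n) ⟩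
    (3 ^ n) ^ D * #proper Δ E ^ D            ≡⟨ ^-distribʳ-* (3 ^ n) (#proper Δ E) D ⟨
    (3 ^ n * #proper Δ E) ^ D                ∎)
    where
    open ≤-Reasoning
    all : Fin n → Bool
    all _ = true
    W-all≤ : W all ≤ #proper Δ E ^ D
    W-all≤ = subst (_≤ #proper Δ E ^ D) q^[D*[n∸n]]*W≡W (lower-bound n all (trans (∑-const n 1) (*-identityʳ n)))
      where
      q^[D*[n∸n]]*W≡W : q ^ (D * (n ∸ n)) * W all ≡ W all
      q^[D*[n∸n]]*W≡W rewrite n∸n≡0 n | *-zeroʳ D = +-identityʳ (W all)

-- Greedy covering

length-filter+length-filter-¬ : ∀ {a p} {A : Set a} {P : A → Set p} (P? : ∀ x → Dec (P x)) xs →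
  length (filter P? xs) + length (filter (λ x → ¬? (P? x)) xs) ≡ length xs
length-filter+length-filter-¬ P? [] = refl
length-filter+length-filter-¬ P? (x ∷ xs) with does (P? x)
... | true = cong suc (length-filter+length-filter-¬ P? xs)
... | false = trans (+-suc _ _) (cong suc (length-filter+length-filter-¬ P? xs))

module GreedyCover {X Y : Set} {_covers_ : Y → X → Set} (covers? : ∀ y x → Dec (y covers x))
                   (Good : X → Set) (M : ℕ) (best : List X → Y)
                   (best-covers : ∀ R → All Good R → length R ≤ M * length (filter (covers? (best R)) R)) where

  uncovered : Y → List X → List X
  uncovered y = filter (λ x → ¬? (covers? y x))

  remaining : ℕ → List X → List X
  remaining zero R = R
  remaining (suc t) R = remaining t (uncovered (best R) R)

  covered : ∀ t R {x} → x ∈ R → remaining t R ≡ [] → ∃[ i ] i < t × best (remaining i R) covers x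
  covered zero R x∈R R≡[] = contradiction (subst (_ ∈_) R≡[] x∈R) λ ()
  covered (suc t) R {x} x∈R rest≡[] with covers? (best R) x
  ... | yes covers = zero , z<s , covers
  ... | no ¬covers with covered t (uncovered (best R) R) (∈-filter⁺ (λ x → ¬? (covers? (best R) x)) x∈R ¬covers) rest≡[]
  ...   | i , i<t , coversᵢ = suc i , s<s i<t , coversᵢ

  uncovered-shrinks : ∀ R → All Good R → M * length (uncovered (best R) R) ≤ (M ∸ 1) * length R
  uncovered-shrinks R good = begin
    M * u                 ≡⟨ m+n∸m≡n (length R) (M * u) ⟨
    length R + M * u ∸ length R ≤⟨ ∸-monoˡ-≤ (length R) (+-monoˡ-≤ (M * u) (best-covers R good)) ⟩
    M * c + M * u ∸ length R    ≡⟨ cong (_∸ length R) (*-distribˡ-+ M c u) ⟨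
    M * (c + u) ∸ length R      ≡⟨ cong (λ l → M * l ∸ length R) (length-filter+length-filter-¬ (covers? (best R)) R) ⟩
    M * length R ∸ length R     ≡⟨ cong (M * length R ∸_) (*-identityˡ (length R)) ⟨
    M * length R ∸ 1 * length R ≡⟨ *-distribʳ-∸ (length R) M 1 ⟨
    (M ∸ 1) * length R          ∎
    where
    open ≤-Reasoning
    c u : ℕ
    c = length (filter (covers? (best R)) R)
    u = length (uncovered (best R) R)

  remaining-decays : ∀ t R → All Good R → M ^ t * length (remaining t R) ≤ (M ∸ 1) ^ t * length R
  remaining-decays zero R _ = ≤-refl
  remaining-decays (suc t) R good = begin
    M * M ^ t * length (remaining t R′)       ≡⟨ *-assoc M (M ^ t) _ ⟩
    M * (M ^ t * length (remaining t R′))     ≤⟨ *-monoʳ-≤ M (remaining-decays t R′ (filter⁺ _ good)) ⟩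
    M * ((M ∸ 1) ^ t * length R′)             ≡⟨ x*[y*z]≡y*[x*z] M ((M ∸ 1) ^ t) (length R′) ⟩
    (M ∸ 1) ^ t * (M * length R′)             ≤⟨ *-monoʳ-≤ ((M ∸ 1) ^ t) (uncovered-shrinks R good) ⟩
    (M ∸ 1) ^ t * ((M ∸ 1) * length R)        ≡⟨ x*[y*z]≡y*[x*z] ((M ∸ 1) ^ t) (M ∸ 1) (length R) ⟩
    (M ∸ 1) * ((M ∸ 1) ^ t * length R)        ≡⟨ *-assoc (M ∸ 1) ((M ∸ 1) ^ t) (length R) ⟨
    (M ∸ 1) ^ suc t * length R                ∎
    where
    open ≤-Reasoning
    R′ : List X
    R′ = uncovered (best R) R

  2^P*|remaining|≤|R| : ∀ P R .{{_ : NonZero M}} → All Good R → 2 ^ P * length (remaining (M * P) R) ≤ length R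
  2^P*|remaining|≤|R| P R good = *-cancelˡ-≤ (M ^ T) {{m^n≢0 M T}} (begin
    M ^ T * (2 ^ P * length (remaining T R)) ≡⟨ x*[y*z]≡y*[x*z] (M ^ T) (2 ^ P) _ ⟩
    2 ^ P * (M ^ T * length (remaining T R)) ≤⟨ *-monoʳ-≤ (2 ^ P) (remaining-decays T R good) ⟩
    2 ^ P * ((M ∸ 1) ^ T * length R)         ≡⟨ *-assoc (2 ^ P) ((M ∸ 1) ^ T) (length R) ⟨
    2 ^ P * (M ∸ 1) ^ T * length R           ≤⟨ *-monoˡ-≤ (length R) (2^P*[M∸1]^[M*P]≤M^[M*P] M P) ⟩
    M ^ T * length R                         ∎)
    where
    open ≤-Reasoning
    T : ℕ
    T = M * P

  remaining-empties : ∀ P R .{{_ : NonZero M}} → All Good R → length R < 2 ^ P → remaining (M * P) R ≡ []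
  remaining-empties P R good |R|<2^P with remaining (M * P) R | 2^P*|remaining|≤|R| P R good
  ... | [] | _ = refl
  ... | _ ∷ rest | 2^P*[1+|rest|]≤|R| =
    contradiction (≤-trans (m≤m*n (2 ^ P) (suc (length rest))) 2^P*[1+|rest|]≤|R|) (<⇒≱ |R|<2^P)

fromBits : List Bool → ℕ
fromBits [] = 0
fromBits (b ∷ bs) = ⟦ b ⟧ * 2 ^ length bs + fromBits bs

bits : ∀ L i → i < 2 ^ L → ∃[ bs ] length bs ≡ L × fromBits bs ≡ i
bits zero zero _ = [] , refl , refl
bits zero (suc i) (s<s ())
bits (suc L) i i<2^[1+L] with i <? 2 ^ L
... | yes i<2^L with bits L i i<2^L
...   | bs , refl , refl = false ∷ bs , refl , refl
bits (suc L) i i<2^[1+L] | no i≮2^L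
  with bits L (i ∸ 2 ^ L) (m<n+o⇒m∸n<o i (2 ^ L) {{m^n≢0 2 L}} (subst (i <_) (cong (2 ^ L +_) (+-identityʳ _)) i<2^[1+L]))
...   | bs , refl , bs≡ = true ∷ bs , refl , trans (cong₂ _+_ (+-identityʳ (2 ^ L)) bs≡) (m+[n∸m]≡n (≮⇒≥ i≮2^L))

length-cartesianProductWith : ∀ {A B C : Set} (f : A → B → C) xs ys →
  length (cartesianProductWith f xs ys) ≡ length xs * length ys
length-cartesianProductWith f [] ys = refl
length-cartesianProductWith f (x ∷ xs) ys = begin
  length (map (f x) ys ++ cartesianProductWith f xs ys)        ≡⟨ length-++ (map (f x) ys) ⟩
  length (map (f x) ys) + length (cartesianProductWith f xs ys)
    ≡⟨ cong₂ _+_ (length-map (f x) ys) (length-cartesianProductWith f xs ys) ⟩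
  length ys + length xs * length ys                             ∎
  where open ≡-Reasoning

vectors : ∀ {A : Set} → List A → (m : ℕ) → List (Vec A m)
vectors xs zero = [] ∷ []
vectors xs (suc m) = cartesianProductWith _∷_ xs (vectors xs m)

length-vectors : ∀ {A : Set} (xs : List A) m → length (vectors xs m) ≡ length xs ^ m
length-vectors xs zero = refl
length-vectors xs (suc m) =
  trans (length-cartesianProductWith _∷_ xs (vectors xs m)) (cong (length xs *_) (length-vectors xs m))

∈-vectors : ∀ {A : Set} {xs : List A} {m} (v : Vec A m) → (∀ i → lookup v i ∈ xs) → v ∈ vectors xs m
∈-vectors [] _ = here refl
∈-vectors (x ∷ v) ∈xs = ∈-cartesianProductWith⁺ _∷_ (∈xs zero) (∈-vectors v (∈xs ∘ suc))

length-filterᵇ-tabulate : ∀ {A : Set} {n} (p : A → Bool) (f : Fin n → A) →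
  length (filterᵇ p (tabulate f)) ≡ ∑[ i < n ] ⟦ p (f i) ⟧
length-filterᵇ-tabulate {n = zero} p f = refl
length-filterᵇ-tabulate {n = suc n} p f with p (f zero)
... | true = cong suc (length-filterᵇ-tabulate p (f ∘ suc))
... | false = length-filterᵇ-tabulate p (f ∘ suc)

degree≡count : ∀ {n} (E : EdgeSet n) u → degree E u ≡ count (E u)
degree≡count E u = length-filterᵇ-tabulate (E u) (λ v → v)

length-filter-∷ : ∀ {a p} {A : Set a} {P : A → Set p} (P? : ∀ x → Dec (P x)) x xs →
  length (filter P? (x ∷ xs)) ≡ ⟦ does (P? x) ⟧ + length (filter P? xs)
length-filter-∷ P? x xs with does (P? x)
... | true = refl
... | false = refl

GoodGraph : ∀ {n} → ℕ → EdgeSet n → Set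
GoodGraph Δ E = IsGraph E × (∀ v → count (E v) ≤ Δ)

goodGraph? : ∀ {n} Δ (E : EdgeSet n) → Dec (GoodGraph Δ E)
goodGraph? Δ E = ((all? λ u → all? λ v → E u v Bool.≟ E v u) ×-dec (all? λ u → E u u Bool.≟ false))
                 ×-dec (all? λ v → count (E v) ≤? Δ)

-- The protocol

module Protocol (n Δ : ℕ) where

  q : ℕ
  q = suc Δ

  Matrix : Set
  Matrix = Vec (Vec Bool n) n

  edges : Matrix → EdgeSet n
  edges A u v = lookup (lookup A u) v

  covers? : (C : Vec (Fin q) n) (A : Matrix) → Dec (Proper (edges A) C)
  covers? C A = proper? (edges A) C

  #covered : List Matrix → Vec (Fin q) n → ℕ
  #covered R C = length (filter (covers? C) R)

  q^n*|R|≤3^n*∑#covered : ∀ R → All (GoodGraph Δ ∘ edges) R → q ^ n * length R ≤ 3 ^ n * ∑ᶜ n (#covered R)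
  q^n*|R|≤3^n*∑#covered [] [] = ≤-trans (≤-reflexive (*-zeroʳ (q ^ n))) z≤n
  q^n*|R|≤3^n*∑#covered (A ∷ R) ((isGraph , Δ-bound) ∷ good) = begin
    q ^ n * suc (length R)                                 ≡⟨ *-suc (q ^ n) (length R) ⟩
    q ^ n + q ^ n * length R
      ≤⟨ +-mono-≤ (Density.proper-colourings-dense isGraph Δ-bound) (q^n*|R|≤3^n*∑#covered R good) ⟩
    3 ^ n * #proper Δ (edges A) + 3 ^ n * ∑ᶜ n (#covered R) ≡⟨ *-distribˡ-+ (3 ^ n) _ _ ⟨
    3 ^ n * (#proper Δ (edges A) + ∑ᶜ n (#covered R))      ≡⟨ cong (3 ^ n *_) (∑ᶜ-distrib-+ n _ _) ⟨
    3 ^ n * ∑ᶜ n (λ C → ⟦ does (covers? C A) ⟧ + #covered R C)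
      ≡⟨ cong (3 ^ n *_) (∑ᶜ-cong n (λ C → length-filter-∷ (covers? C) A R)) ⟨
    3 ^ n * ∑ᶜ n (#covered (A ∷ R))                        ∎
    where open ≤-Reasoning

  best : List Matrix → Vec (Fin q) n
  best R = proj₁ (∑ᶜ≤q^m*max n (#covered R))

  best-covers : ∀ R → All (GoodGraph Δ ∘ edges) R → length R ≤ 3 ^ n * #covered R (best R)
  best-covers R good = *-cancelˡ-≤ (q ^ n) {{m^n≢0 q n}} (begin
    q ^ n * length R                  ≤⟨ q^n*|R|≤3^n*∑#covered R good ⟩
    3 ^ n * ∑ᶜ n (#covered R)         ≤⟨ *-monoʳ-≤ (3 ^ n) (proj₂ (∑ᶜ≤q^m*max n (#covered R))) ⟩
    3 ^ n * (q ^ n * #covered R (best R)) ≡⟨ x*[y*z]≡y*[x*z] (3 ^ n) (q ^ n) _ ⟩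
    q ^ n * (3 ^ n * #covered R (best R)) ∎)
    where open ≤-Reasoning

  open GreedyCover covers? (GoodGraph Δ ∘ edges) (3 ^ n) best best-covers

  booleans : List Bool
  booleans = true ∷ false ∷ []

  graphs : List Matrix
  graphs = filter (goodGraph? Δ ∘ edges) (vectors (vectors booleans n) n)

  |graphs|<2^[1+n*n] : length graphs < 2 ^ suc (n * n)
  |graphs|<2^[1+n*n] = begin-strict
    length graphs                          ≤⟨ length-filter (goodGraph? Δ ∘ edges) (vectors (vectors booleans n) n) ⟩
    length (vectors (vectors booleans n) n) ≡⟨ length-vectors (vectors booleans n) n ⟩
    length (vectors booleans n) ^ n        ≡⟨ cong (_^ n) (length-vectors booleans n) ⟩
    (2 ^ n) ^ n                            ≡⟨ ^-*-assoc 2 n n ⟩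
    2 ^ (n * n)                            <⟨ ^-monoʳ-< 2 (s≤s (s≤s z≤n)) (n<1+n (n * n)) ⟩
    2 ^ suc (n * n)                        ∎
    where open ≤-Reasoning

  rounds : ℕ
  rounds = 3 ^ n * suc (n * n)

  family : ℕ → Vec (Fin q) n
  family i = best (remaining i graphs)

  decode : List Bool → Vec (Fin q) n
  decode m = family (fromBits m)

  accepts : EdgeSet n → List Bool → Bool
  accepts E m = does (proper? E (decode m))

  protocol : NDProtocol n Δ
  protocol = record
    { acceptA = accepts
    ; outA = λ _ m → lookup (decode m)
    ; acceptB = accepts
    ; outB = λ _ m → lookup (decode m)
    }

  all-covered : remaining rounds graphs ≡ []
  all-covered = remaining-empties (suc (n * n)) graphs {{m^n≢0 3 n}}
                  (all-filter (goodGraph? Δ ∘ edges) (vectors (vectors booleans n) n)) |graphs|<2^[1+n*n]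

  ∈-booleans : ∀ b → b ∈ booleans
  ∈-booleans true = here refl
  ∈-booleans false = there (here refl)

  matrix : EdgeSet n → Matrix
  matrix E = Vec.tabulate (λ u → Vec.tabulate (E u))

  edges-matrix : ∀ E u v → edges (matrix E) u v ≡ E u v
  edges-matrix E u v = trans (cong (λ r → lookup r v) (lookup∘tabulate _ u)) (lookup∘tabulate (E u) v)

  matrix∈graphs : ∀ E → GoodGraph Δ E → matrix E ∈ graphs
  matrix∈graphs E ((E-sym , E-loopless) , Δ-bound) =
    ∈-filter⁺ (goodGraph? Δ ∘ edges) (∈-vectors (matrix E) (λ u → ∈-vectors (lookup (matrix E) u) (∈-booleans ∘ _)))
      ((sym′ , loopless′) , Δ-bound′)
    where
    sym′ : ∀ u v → edges (matrix E) u v ≡ edges (matrix E) v u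
    sym′ u v = trans (edges-matrix E u v) (trans (E-sym u v) (sym (edges-matrix E v u)))
    loopless′ : ∀ u → edges (matrix E) u u ≡ false
    loopless′ u = trans (edges-matrix E u u) (E-loopless u)
    Δ-bound′ : ∀ v → count (edges (matrix E) v) ≤ Δ
    Δ-bound′ v = subst (_≤ Δ) (sum-cong-≗ (cong ⟦_⟧ ∘ sym ∘ edges-matrix E v)) (Δ-bound v)

  good-union : ∀ {EA EB} → ValidInput n Δ EA EB → GoodGraph Δ (EA ∪E EB)
  good-union {EA} {EB} ((symA , looplessA) , (symB , looplessB) , _ , degree≤Δ , _) =
    ((λ u v → cong₂ _∨_ (symA u v) (symB u v)) , (λ u → cong₂ _∨_ (looplessA u) (looplessB u)))
    , (λ v → subst (_≤ Δ) (degree≡count (EA ∪E EB) v) (degree≤Δ v))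

  completeness : ∀ EA EB → ValidInput n Δ EA EB → ∃[ m ] length m ≤ 4 * n × accepts EA m ≡ true × accepts EB m ≡ true
  completeness EA EB valid = m , ≤-reflexive (proj₁ (proj₂ message))
    , dec-true (proper? EA (decode m)) (proper-subgraph {E = G} {C = decode m} EA⊆G proper-G)
    , dec-true (proper? EB (decode m)) (proper-subgraph {E = G} {C = decode m} EB⊆G proper-G)
    where
    G : EdgeSet n
    G = EA ∪E EB
    witness : ∃[ i ] i < rounds × Proper (edges (matrix G)) (family i)
    witness = covered rounds graphs (matrix∈graphs G (good-union valid)) all-covered
    message : ∃[ bs ] length bs ≡ 4 * n × fromBits bs ≡ proj₁ witness
    message = bits (4 * n) (proj₁ witness) (≤-trans (proj₁ (proj₂ witness)) (3^n*[1+n*n]≤2^[4*n] n))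
    m : List Bool
    m = proj₁ message
    proper-G : Proper G (decode m)
    proper-G = subst (λ i → Proper G (family i)) (sym (proj₂ (proj₂ message)))
      (proper-subgraph {E = edges (matrix G)} {C = family (proj₁ witness)} G⊆matrix (proj₂ (proj₂ witness)))
      where
      G⊆matrix : ∀ u v → G u v ≡ true → edges (matrix G) u v ≡ true
      G⊆matrix u v Guv = trans (edges-matrix G u v) Guv
    EA⊆G : ∀ u v → EA u v ≡ true → G u v ≡ true
    EA⊆G u v EAuv = cong (_∨ EB u v) EAuv
    EB⊆G : ∀ u v → EB u v ≡ true → G u v ≡ true
    EB⊆G u v EBuv = trans (cong (EA u v ∨_) EBuv) (Bool.∨-zeroʳ (EA u v))

  soundness : ∀ EA EB m → accepts EA m ≡ true → accepts EB m ≡ true → ProperColoring (EA ∪E EB) (lookup (decode m))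
  soundness EA EB m acceptedA acceptedB u v Guv =
    [ does≡true⇒ (proper? EA (decode m)) acceptedA u v , does≡true⇒ (proper? EB (decode m)) acceptedB u v ]′
      (∨≡true⇒ (EA u v) Guv)

  correct : CorrectWithCost protocol (4 * n)
  correct EA EB valid = completeness EA EB valid , λ m acceptedA acceptedB → refl , soundness EA EB m acceptedA acceptedB

theorem3p1 : ∃[ c ] ((n Δ : ℕ) → ∃[ P ] CorrectWithCost {n} {Δ} P (c * n))
theorem3p1 = 4 , λ n Δ → Protocol.protocol n Δ , Protocol.correct n Δ
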